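{- Let $n\ge 6$ be an even integer and let $$f_{n,2}(x)=2\sum_{j\geq 0}\binom{n-1}{2j+1}(x^j-x^{j+1})+2\sum_{j\geq 0}\binom{n}{2j}x^j\in\mathbb{Z}[x],\qquad C_n(x):=f_{n,2}(x)-2n\,x^{n/2-1}.$$ Then, with $N=n/2-1$, $C_n(x)$ (which has degree less than $N$) viewed as an element of $\mathbb{Z}[x]/(x^N-1)$ is a coterm polynomial.
   Context: For a commutative ring $R$ with identity and $N\ge1$, a polynomial $a_0+a_1x+\cdots+a_{N-1}x^{N-1}\in R[x]/(x^N-1)$ with $a_i\in R$ is a coterm polynomial if $a_i=a_{N-i}$ for all $1\le i\le\lfloor N/2\rfloor$. Binomial coefficients $\binom{a}{b}$ are $0$ when $b>a$. -}

module Defs where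

open import Data.Nat using (ℕ; zero; suc; _≤_; _∸_; _/_)
open import Data.Nat.Combinatorics using (_C_)
open import Data.Integer using (ℤ; +_; _+_; _-_; _*_)
open import Relation.Binary.PropositionalEquality using (_≡_)
open import Relation.Nullary.Decidable using (⌊_⌋)
import Data.Nat as ℕ

-- A polynomial in R[x]/(x^N - 1) with coefficients a_0, ..., a_{N-1}
-- (given by a coefficient function a : ℕ → ℤ, only indices < N matter)
-- is coterm if a_i = a_{N-i} for all 1 ≤ i ≤ ⌊N/2⌋.
IsCoterm : (N : ℕ) → (ℕ → ℤ) → Set
IsCoterm N a = ∀ i → 1 ≤ i → i ≤ N / 2 → a i ≡ a (N ∸ i)

-- Coefficient of x^k in  Σ_{j≥0} c_j (x^j - x^{j+1}),  i.e. c_k - c_{k-1} (c_{-1} = 0).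
telescopeCoeff : (ℕ → ℤ) → ℕ → ℤ
telescopeCoeff c zero    = c zero
telescopeCoeff c (suc k) = c (suc k) - c k

fCoeff : ℕ → ℕ → ℤ
fCoeff n k =
  + 2 * telescopeCoeff (λ j → + ((n ∸ 1) C (2 ℕ.* j ℕ.+ 1))) k
  + + 2 * + (n C (2 ℕ.* k))

monoCoeff : ℕ → ℕ → ℤ
monoCoeff e k = if ⌊ e ℕ.≟ k ⌋ then + 1 else + 0
  where
  open import Data.Bool using (if_then_else_)

cCoeff : ℕ → ℕ → ℤ
cCoeff n k = fCoeff n k - + (2 ℕ.* n) * monoCoeff (n / 2 ∸ 1) k

module Submission where

open import Defs
open import Data.Nat using (ℕ; _≤_; _<_; _/_; _∸_)
open import Data.Nat.Divisibility using (_∣_)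
open import Data.Integer using (+_)
open import Data.Product using (_×_)
open import Relation.Binary.PropositionalEquality using (_≡_)

open import Data.Nat as ℕ using (zero; suc; z≤n; s≤s; z<s)
open import Data.Nat.Properties
open import Data.Nat.DivMod using (m*n/n≡m; m/n<m)
open import Data.Nat.Divisibility using (divides)
open import Data.Nat.Combinatorics using (_C_; nC1≡n; nCk≡nC[n∸k]; k>n⇒nCk≡0; nCk+nC[k+1]≡[n+1]C[k+1])
open import Data.Integer as ℤ using (ℤ)
open import Data.Integer.Properties using (pos-+; pos-*)
import Data.Integer.Tactic.RingSolver as ℤ-Solver
import Data.Nat.Tactic.RingSolver as ℕ-Solver
open import Data.Product using (_,_)
open import Relation.Binary.PropositionalEquality using (refl; sym; trans; cong; subst; cong₂; _≢_; module ≡-Reasoning)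
open import Relation.Nullary using (yes; no; contradiction)

-- By Pascal's rule the telescoping sum collapses: the coefficient of x^k in
-- f_{n,2} is 2·C(n,2k+1).  For n = 2(N+1) the symmetry C(n,j) = C(n,n-j)
-- maps 2k+1 to 2(N-k)+1, which is the coterm symmetry k ↦ N-k; the only
-- surviving coefficient at or above degree N is 2·C(n,2N+1) = 2n, and it is
-- exactly cancelled by the monomial 2n·x^N.

monoCoeff-refl : ∀ e → monoCoeff e e ≡ + 1
monoCoeff-refl e with e ℕ.≟ e
... | yes _  = refl
... | no e≢e = contradiction refl e≢e

monoCoeff-≢ : ∀ {e k} → e ≢ k → monoCoeff e k ≡ + 0
monoCoeff-≢ {e} {k} e≢k with e ℕ.≟ k
... | yes e≡k = contradiction e≡k e≢k
... | no _    = refl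

2[1+k]≡1+[2k+1] : ∀ k → 2 ℕ.* suc k ≡ suc (2 ℕ.* k ℕ.+ 1)
2[1+k]≡1+[2k+1] = ℕ-Solver.solve-∀

2[1+k]+1≡2+[2k+1] : ∀ k → 2 ℕ.* suc k ℕ.+ 1 ≡ suc (suc (2 ℕ.* k ℕ.+ 1))
2[1+k]+1≡2+[2k+1] = ℕ-Solver.solve-∀

fCoeff[1+m]≡2*[1+m]C[2k+1] : ∀ m k → fCoeff (suc m) k ≡ + 2 ℤ.* + (suc m C (2 ℕ.* k ℕ.+ 1))
fCoeff[1+m]≡2*[1+m]C[2k+1] m zero = begin
  + 2 ℤ.* + (m C 1) ℤ.+ + 2 ℤ.* + (m C 0)  ≡⟨ 2a+2b≡2[b+a] (+ (m C 1)) (+ (m C 0)) ⟩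
  + 2 ℤ.* (+ (m C 0) ℤ.+ + (m C 1))        ≡⟨ cong (+ 2 ℤ.*_) (sym (pos-+ (m C 0) (m C 1))) ⟩
  + 2 ℤ.* + (m C 0 ℕ.+ m C 1)              ≡⟨ cong (λ c → + 2 ℤ.* + c) (nCk+nC[k+1]≡[n+1]C[k+1] m 0) ⟩
  + 2 ℤ.* + (suc m C 1)                    ∎
  where
  open ≡-Reasoning
  2a+2b≡2[b+a] : ∀ (a b : ℤ) → + 2 ℤ.* a ℤ.+ + 2 ℤ.* b ≡ + 2 ℤ.* (b ℤ.+ a)
  2a+2b≡2[b+a] = ℤ-Solver.solve-∀
fCoeff[1+m]≡2*[1+m]C[2k+1] m (suc k) = begin
  fCoeff (suc m) (suc k)
    ≡⟨ cong₂ (λ i l → + 2 ℤ.* (+ (m C i) ℤ.- + a) ℤ.+ + 2 ℤ.* + (suc m C l))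
             (2[1+k]+1≡2+[2k+1] k) (2[1+k]≡1+[2k+1] k) ⟩
  + 2 ℤ.* (+ c ℤ.- + a) ℤ.+ + 2 ℤ.* + (suc m C suc j)
    ≡⟨ cong (λ x → + 2 ℤ.* (+ c ℤ.- + a) ℤ.+ + 2 ℤ.* + x) (sym (nCk+nC[k+1]≡[n+1]C[k+1] m j)) ⟩
  + 2 ℤ.* (+ c ℤ.- + a) ℤ.+ + 2 ℤ.* + (a ℕ.+ b)
    ≡⟨ cong (λ x → + 2 ℤ.* (+ c ℤ.- + a) ℤ.+ + 2 ℤ.* x) (pos-+ a b) ⟩
  + 2 ℤ.* (+ c ℤ.- + a) ℤ.+ + 2 ℤ.* (+ a ℤ.+ + b)
    ≡⟨ telescope (+ a) (+ b) (+ c) ⟩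
  + 2 ℤ.* (+ b ℤ.+ + c)
    ≡⟨ cong (+ 2 ℤ.*_) (sym (pos-+ b c)) ⟩
  + 2 ℤ.* + (b ℕ.+ c)
    ≡⟨ cong (λ x → + 2 ℤ.* + x) (nCk+nC[k+1]≡[n+1]C[k+1] m (suc j)) ⟩
  + 2 ℤ.* + (suc m C suc (suc j))
    ≡⟨ cong (λ i → + 2 ℤ.* + (suc m C i)) (sym (2[1+k]+1≡2+[2k+1] k)) ⟩
  + 2 ℤ.* + (suc m C (2 ℕ.* suc k ℕ.+ 1))
    ∎
  where
  open ≡-Reasoning
  j a b c : ℕ
  j = 2 ℕ.* k ℕ.+ 1
  a = m C j
  b = m C suc j
  c = m C suc (suc j)
  telescope : ∀ (a b c : ℤ) → + 2 ℤ.* (c ℤ.- a) ℤ.+ + 2 ℤ.* (a ℤ.+ b) ≡ + 2 ℤ.* (b ℤ.+ c)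
  telescope = ℤ-Solver.solve-∀

0<i≤m/2⇒i<m : ∀ {i m} → 0 < i → i ≤ m / 2 → i < m
0<i≤m/2⇒i<m {m = zero}  0<i i≤0 = contradiction (≤-trans 0<i i≤0) λ ()
0<i≤m/2⇒i<m {m = suc m} _   i≤m/2 = ≤-<-trans i≤m/2 (m/n<m (suc m) 2 (s≤s (s≤s z≤n)))

module _ (N : ℕ) where

  private
    n : ℕ
    n = suc N ℕ.* 2

    2i+1≤n : ∀ {i} → i ≤ N → 2 ℕ.* i ℕ.+ 1 ≤ n
    2i+1≤n {i} i≤N = begin
      2 ℕ.* i ℕ.+ 1         ≤⟨ +-monoˡ-≤ 1 (*-monoʳ-≤ 2 i≤N) ⟩
      2 ℕ.* N ℕ.+ 1         ≤⟨ n≤1+n _ ⟩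
      suc (2 ℕ.* N ℕ.+ 1)   ≡⟨ 1+[2N+1]≡[1+N]*2 N ⟩
      n                     ∎
      where
      open ≤-Reasoning
      1+[2N+1]≡[1+N]*2 : ∀ N → suc (2 ℕ.* N ℕ.+ 1) ≡ suc N ℕ.* 2
      1+[2N+1]≡[1+N]*2 = ℕ-Solver.solve-∀

    n<2k+1 : ∀ {k} → N < k → n < 2 ℕ.* k ℕ.+ 1
    n<2k+1 {k} N<k = begin-strict
      n                    ≡⟨ *-comm (suc N) 2 ⟩
      2 ℕ.* suc N          <⟨ m<m+n _ z<s ⟩
      2 ℕ.* suc N ℕ.+ 1    ≤⟨ +-monoˡ-≤ 1 (*-monoʳ-≤ 2 N<k) ⟩
      2 ℕ.* k ℕ.+ 1        ∎
      where open ≤-Reasoning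

    n∸[2i+1]≡2[N∸i]+1 : ∀ {i} → i ≤ N → n ∸ (2 ℕ.* i ℕ.+ 1) ≡ 2 ℕ.* (N ∸ i) ℕ.+ 1
    n∸[2i+1]≡2[N∸i]+1 {i} i≤N = begin
      n ∸ (2 ℕ.* i ℕ.+ 1)
        ≡⟨ cong (λ M → suc M ℕ.* 2 ∸ (2 ℕ.* i ℕ.+ 1)) (sym (m∸n+n≡m i≤N)) ⟩
      suc (N ∸ i ℕ.+ i) ℕ.* 2 ∸ (2 ℕ.* i ℕ.+ 1)
        ≡⟨ cong (_∸ (2 ℕ.* i ℕ.+ 1)) (split (N ∸ i) i) ⟩
      2 ℕ.* (N ∸ i) ℕ.+ 1 ℕ.+ (2 ℕ.* i ℕ.+ 1) ∸ (2 ℕ.* i ℕ.+ 1)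
        ≡⟨ m+n∸n≡m _ (2 ℕ.* i ℕ.+ 1) ⟩
      2 ℕ.* (N ∸ i) ℕ.+ 1
        ∎
      where
      open ≡-Reasoning
      split : ∀ t i → suc (t ℕ.+ i) ℕ.* 2 ≡ 2 ℕ.* t ℕ.+ 1 ℕ.+ (2 ℕ.* i ℕ.+ 1)
      split = ℕ-Solver.solve-∀

  nC[2[N∸i]+1]≡nC[2i+1] : ∀ {i} → i ≤ N → n C (2 ℕ.* (N ∸ i) ℕ.+ 1) ≡ n C (2 ℕ.* i ℕ.+ 1)
  nC[2[N∸i]+1]≡nC[2i+1] i≤N = sym (trans (nCk≡nC[n∸k] (2i+1≤n i≤N)) (cong (n C_) (n∸[2i+1]≡2[N∸i]+1 i≤N)))

  nC[2N+1]≡n : n C (2 ℕ.* N ℕ.+ 1) ≡ n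
  nC[2N+1]≡n = begin
    n C (2 ℕ.* N ℕ.+ 1)          ≡⟨ nC[2[N∸i]+1]≡nC[2i+1] ≤-refl ⟨
    n C (2 ℕ.* (N ∸ N) ℕ.+ 1)    ≡⟨ cong (λ t → n C (2 ℕ.* t ℕ.+ 1)) (n∸n≡0 N) ⟩
    n C 1                        ≡⟨ nC1≡n n ⟩
    n                            ∎
    where open ≡-Reasoning

  cCoeff-via-binomial : ∀ k → cCoeff n k ≡ + 2 ℤ.* + (n C (2 ℕ.* k ℕ.+ 1)) ℤ.- + (2 ℕ.* n) ℤ.* monoCoeff N k
  cCoeff-via-binomial k = cong₂ (λ f e → f ℤ.- + (2 ℕ.* n) ℤ.* monoCoeff (e ∸ 1) k)
                    (fCoeff[1+m]≡2*[1+m]C[2k+1] (suc (N ℕ.* 2)) k) (m*n/n≡m (suc N) 2)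

  cCoeff-≢ : ∀ {k} → N ≢ k → cCoeff n k ≡ + 2 ℤ.* + (n C (2 ℕ.* k ℕ.+ 1))
  cCoeff-≢ {k} N≢k = begin
    cCoeff n k                                                    ≡⟨ cCoeff-via-binomial k ⟩
    + 2 ℤ.* + (n C (2 ℕ.* k ℕ.+ 1)) ℤ.- + (2 ℕ.* n) ℤ.* monoCoeff N k
      ≡⟨ cong (λ e → + 2 ℤ.* + (n C (2 ℕ.* k ℕ.+ 1)) ℤ.- + (2 ℕ.* n) ℤ.* e) (monoCoeff-≢ N≢k) ⟩
    + 2 ℤ.* + (n C (2 ℕ.* k ℕ.+ 1)) ℤ.- + (2 ℕ.* n) ℤ.* + 0     ≡⟨ a-b*0≡a _ (+ (2 ℕ.* n)) ⟩
    + 2 ℤ.* + (n C (2 ℕ.* k ℕ.+ 1))                               ∎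
    where
    open ≡-Reasoning
    a-b*0≡a : ∀ (a b : ℤ) → a ℤ.- b ℤ.* + 0 ≡ a
    a-b*0≡a = ℤ-Solver.solve-∀

  cCoeff-N≡0 : cCoeff n N ≡ + 0
  cCoeff-N≡0 = begin
    cCoeff n N                                                    ≡⟨ cCoeff-via-binomial N ⟩
    + 2 ℤ.* + (n C (2 ℕ.* N ℕ.+ 1)) ℤ.- + (2 ℕ.* n) ℤ.* monoCoeff N N
      ≡⟨ cong₂ (λ c e → + 2 ℤ.* + c ℤ.- + (2 ℕ.* n) ℤ.* e) nC[2N+1]≡n (monoCoeff-refl N) ⟩
    + 2 ℤ.* + n ℤ.- + (2 ℕ.* n) ℤ.* + 1                           ≡⟨ cong (λ x → + 2 ℤ.* + n ℤ.- x ℤ.* + 1) (pos-* 2 n) ⟩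
    + 2 ℤ.* + n ℤ.- + 2 ℤ.* + n ℤ.* + 1                           ≡⟨ a-a*1≡0 (+ 2 ℤ.* + n) ⟩
    + 0                                                           ∎
    where
    open ≡-Reasoning
    a-a*1≡0 : ∀ (a : ℤ) → a ℤ.- a ℤ.* + 1 ≡ + 0
    a-a*1≡0 = ℤ-Solver.solve-∀

  cCoeff-vanishes : ∀ k → N ≤ k → cCoeff n k ≡ + 0
  cCoeff-vanishes k N≤k with N ℕ.≟ k
  ... | yes refl = cCoeff-N≡0
  ... | no N≢k   = trans (cCoeff-≢ N≢k)
                         (cong (λ c → + 2 ℤ.* + c) (k>n⇒nCk≡0 (n<2k+1 (≤∧≢⇒< N≤k N≢k))))

  cCoeff-coterm : IsCoterm N (cCoeff n)
  cCoeff-coterm i 1≤i i≤N/2 = begin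
    cCoeff n i                               ≡⟨ cCoeff-≢ (>⇒≢ i<N) ⟩
    + 2 ℤ.* + (n C (2 ℕ.* i ℕ.+ 1))          ≡⟨ cong (λ c → + 2 ℤ.* + c) (nC[2[N∸i]+1]≡nC[2i+1] (<⇒≤ i<N)) ⟨
    + 2 ℤ.* + (n C (2 ℕ.* (N ∸ i) ℕ.+ 1))    ≡⟨ cCoeff-≢ (>⇒≢ (∸-monoʳ-< {N} {i} {0} 1≤i (<⇒≤ i<N))) ⟨
    cCoeff n (N ∸ i)                         ∎
    where
    open ≡-Reasoning
    i<N : i < N
    i<N = 0<i≤m/2⇒i<m 1≤i i≤N/2

theorem5p3 : (n : ℕ) → 6 ≤ n → 2 ∣ n →
    ((k : ℕ) → n / 2 ∸ 1 ≤ k → cCoeff n k ≡ + 0)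
    × IsCoterm (n / 2 ∸ 1) (cCoeff n)
theorem5p3 _ () (divides zero refl)
theorem5p3 _ _  (divides (suc N) refl) =
  subst (λ M → ((k : ℕ) → M ≤ k → cCoeff n k ≡ + 0) × IsCoterm M (cCoeff n))
        (sym (cong (_∸ 1) (m*n/n≡m (suc N) 2)))
        (cCoeff-vanishes N , cCoeff-coterm N)
  where
  n : ℕ
  n = suc N ℕ.* 2
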